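{- Let $(I,J)$ be a cut induced by a bond of $K_{3,3}$ such that the coloring $\varepsilon_{I,J}$ is surjective. Then, up to swapping $I$ and $J$ and swapping the $P$'s with the $Q$'s, $I$ has the form $\{P_i,Q_i,T_{j_1},T'_{j_2},T''_{j_3}\}$ where $i\in\{1,\dots,6\}$, $j_1<j_2<j_3$ are the three elements of $\{1,\dots,6\}$ of parity different from $i$, and each of $T_{j_1},T'_{j_2},T''_{j_3}$ is either the $P$ or the $Q$ marked point with that index.
   Context: $K_{3,3}$ has vertices $\{1,\dots,6\}$, edges all pairs $\{i,j\}$ with $i$ odd and $j$ even. $\overline{\mathcal{M}}_{0,12}$ is the moduli space of stable genus-zero curves with 12 marked points $P_1,\dots,P_6,Q_1,\dots,Q_6$, $\mathcal{M}_{0,12}$ its open subset of irreducible curves, and $\pi_{a,b}\colon\overline{\mathcal{M}}_{0,12}\to\overline{\mathcal{M}}_{0,4}$ keeps only $P_a,P_b,Q_a,Q_b$. A bond of $K_{3,3}$ is a stable curve $X$ with at least two components such that $\pi_{a,b}(X)\in\mathcal{M}_{0,4}$ for every edge $\{a,b\}$. A cut induced by $X$ at a singular point $z$ is the partition $(I,J)$ of the marked points according to the two connected components of $X\setminus\{z\}$. The coloring $\varepsilon_{I,J}$ colors an edge $\{a,b\}$ red if at least three of $P_a,P_b,Q_a,Q_b$ are in $I$ and blue if at least three are in $J$ (for cuts induced by bonds, exactly one of these happens). -}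

module Defs where

open import Data.Nat using (ℕ; zero; suc; _+_; _≤_; _%_)
open import Data.Fin using (Fin; zero; suc; toℕ; _≟_)
open import Data.Bool using (Bool; true; false; _∨_; not; if_then_else_)
open import Data.List using (List; []; _∷_; _++_; map; length; filterᵇ; allFin)
open import Data.Product using (Σ; ∃; ∃₂; _×_; _,_)
open import Data.Sum using (_⊎_)
open import Relation.Nullary using (¬_)
open import Relation.Nullary.Decidable using (⌊_⌋)
open import Relation.Binary.PropositionalEquality using (_≡_; _≢_)

-- Marked points P₁..P₆, Q₁..Q₆ (index a : Fin 6 stands for a+1).

data Pt : Set where
  P : Fin 6 → Pt
  Q : Fin 6 → Pt

allPts : List Pt
allPts = map P (allFin 6) ++ map Q (allFin 6)

countᵇ : {A : Set} → (A → Bool) → List A → ℕ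
countᵇ f xs = length (filterᵇ f xs)

-- 1 for a non-root vertex (the edge to its parent), 0 for the root
upEdge : {n : ℕ} → Fin (suc n) → ℕ
upEdge zero    = 0
upEdge (suc _) = 1

-- Combinatorial type (dual tree) of a stable genus-0 curve with the 12
-- marked points.  Components are Fin (suc m); component 0 is a chosen
-- root, and component (suc k) is attached by a node to its parent
-- component `parent k`, which has a smaller index (so the dual graph is a
-- tree, with exactly m nodes, one for each k : Fin m).  `mark p` is the
-- component carrying the marked point p.  Stability: every component has
-- at least 3 special points (marked points + nodes).

record StableCurve : Set where
  field
    m       : ℕ
    parent  : Fin m → Fin (suc m)
    parent< : ∀ k → toℕ (parent k) ≤ toℕ k
    mark    : Pt → Fin (suc m)
    stable  : ∀ v → 3 ≤ countᵇ (λ p → ⌊ mark p ≟ v ⌋) allPts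
                        + countᵇ (λ k → ⌊ parent k ≟ v ⌋) (allFin m)
                        + upEdge v

open StableCurve public

-- isDesc f par v w : w lies in the subtree rooted at v (w = v or an
-- ancestor chain of w reaches v), following `par` at most f times.
-- Since parent indices strictly decrease, fuel (suc m) is enough.
isDesc : {m : ℕ} → ℕ → (Fin m → Fin (suc m)) → Fin (suc m) → Fin (suc m) → Bool
isDesc zero    par v w       = ⌊ w ≟ v ⌋
isDesc (suc f) par v zero    = ⌊ zero ≟ v ⌋
isDesc (suc f) par v (suc k) = ⌊ suc k ≟ v ⌋ ∨ isDesc f par v (par k)

-- Side of the node k (between component suc k and its parent):
-- true iff p lies on the connected component of X ∖ {node} containing
-- component (suc k).
side : (X : StableCurve) → Fin (m X) → Pt → Bool
side X k p = isDesc (suc (m X)) (parent X) (suc k) (mark X p)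

K33Edge : Fin 6 → Fin 6 → Set
K33Edge a b = (suc (toℕ a) % 2 ≡ 1) × (suc (toℕ b) % 2 ≡ 0)

cnt4 : (Pt → Bool) → Fin 6 → Fin 6 → ℕ
cnt4 S a b = countᵇ S (P a ∷ P b ∷ Q a ∷ Q b ∷ [])

-- π_{a,b}(X) ∈ M_{0,4}: after forgetting all but P_a,P_b,Q_a,Q_b and
-- stabilizing, the curve is irreducible, i.e. no node of X separates
-- the four points 2|2.
πIrreducible : StableCurve → Fin 6 → Fin 6 → Set
πIrreducible X a b = ∀ k → cnt4 (side X k) a b ≢ 2

IsBond : StableCurve → Set
IsBond X = (1 ≤ m X) × (∀ a b → K33Edge a b → πIrreducible X a b)

-- (I, J) with J = complement of I, given by I : Pt → Bool.
IsInducedCut : StableCurve → (Pt → Bool) → Set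
IsInducedCut X I = ∃ λ k → (∀ p → I p ≡ side X k p) ⊎ (∀ p → I p ≡ not (side X k p))

Red : (Pt → Bool) → Fin 6 → Fin 6 → Set
Red I a b = 3 ≤ cnt4 I a b

Blue : (Pt → Bool) → Fin 6 → Fin 6 → Set
Blue I a b = 3 ≤ cnt4 (λ p → not (I p)) a b

ColoringSurjective : (Pt → Bool) → Set
ColoringSurjective I =
  (∃₂ λ a b → K33Edge a b × Red I a b) × (∃₂ λ a b → K33Edge a b × Blue I a b)

swapPQ : Pt → Pt
swapPQ (P a) = Q a
swapPQ (Q a) = P a

swapped : Bool → Bool → (Pt → Bool) → Pt → Bool
swapped sIJ sPQ I p =
  (if sIJ then not else (λ x → x)) (I (if sPQ then swapPQ p else p))

parity : Fin 6 → ℕ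
parity j = toℕ j % 2

pick : Bool → Fin 6 → Pt
pick true  j = P j
pick false j = Q j

HasForm : (Pt → Bool) → Set
HasForm S = ∃₂ λ (i : Fin 6) (c : Fin 6 → Bool) → ∀ p →
  (S p ≡ true → (p ≡ P i ⊎ p ≡ Q i ⊎ ∃ λ j → parity j ≢ parity i × p ≡ pick (c j) j))
  × ((p ≡ P i ⊎ p ≡ Q i ⊎ ∃ λ j → parity j ≢ parity i × p ≡ pick (c j) j) → S p ≡ true)

-- Write ℓ j ∈ {0,1,2} for the number of P_j, Q_j lying in I. The number of
-- P_a, P_b, Q_a, Q_b in I is ℓ a + ℓ b, so a bond forbids ℓ a + ℓ b = 2 on
-- every edge: the values on the odd side and on the even side never form one of
-- the pairs (1,1), (0,2), (2,0). A red edge needs a 2 and a blue edge needs a 0;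
-- they cannot lie on opposite sides, so one side carries only 0s and 2s and the
-- other side only 1s. Up to exchanging I and J that side has a single 2 at some
-- index i, and I is {P_i, Q_i} together with one point of each index of the
-- other parity. This step about load profiles is verified by evaluation over all
-- 3⁶ of them.
module Submission where

open import Defs
open import Data.Bool using (Bool; true; false; not)
open import Data.Fin using (Fin; _≟_)
open import Data.Fin.Properties using (all?; any?)
open import Data.List using ([]; _∷_; map)
open import Data.Nat using (ℕ; _+_; _≤_; _≤?_)
import Data.Nat as ℕ
open import Data.Product using (∃; ∃₂; _×_; _,_; proj₁; proj₂; map₂; uncurry)
open import Data.Sum using (_⊎_; inj₁; inj₂)
import Data.Sum as Sum
open import Data.Vec using (Vec; []; _∷_; lookup; tabulate)
open import Data.Vec.Properties using (lookup∘tabulate)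
open import Function using (id; _∘_; _⇔_; mk⇔; Equivalence)
import Function.Properties.Equivalence as ⇔
open import Relation.Binary.Definitions using (DecidableEquality)
open import Relation.Binary.PropositionalEquality using (_≡_; _≢_; _≗_; refl; sym; trans; cong; cong₂; subst)
open import Relation.Nullary using (Dec; yes; no; ¬_; contradiction)
open import Relation.Nullary.Decidable using (map′; ¬?; _×-dec_; _⊎-dec_; _→-dec_; from-yes)
open import Relation.Unary using (Pred; Decidable)
open import Level using (0ℓ)

Searchable : Set → Set₁
Searchable A = {P : Pred A 0ℓ} → Decidable P → Dec (∀ x → P x)

searchable-Vec : {A : Set} → Searchable A → ∀ n → Searchable (Vec A n)
searchable-Vec search-A ℕ.zero P? =
  map′ (λ { p [] → p }) (λ ∀P → ∀P []) (P? [])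
searchable-Vec search-A (ℕ.suc n) P? =
  map′ (λ { ∀P (x ∷ v) → ∀P x v }) (λ ∀P x v → ∀P (x ∷ v))
       (search-A (λ x → searchable-Vec search-A n (λ v → P? (x ∷ v))))

data Load : Set where
  none one both : Load

weight : Load → ℕ
weight none = 0
weight one  = 1
weight both = 2

complement : Load → Load
complement none = both
complement one  = one
complement both = none

_≟ᴸ_ : DecidableEquality Load
none ≟ᴸ none = yes refl
one  ≟ᴸ one  = yes refl
both ≟ᴸ both = yes refl
none ≟ᴸ one  = no λ ()
none ≟ᴸ both = no λ ()
one  ≟ᴸ none = no λ ()
one  ≟ᴸ both = no λ ()
both ≟ᴸ none = no λ ()
both ≟ᴸ one  = no λ ()

searchable-Load : Searchable Load
searchable-Load P? =
  map′ (λ { (p , _ , _) none → p ; (_ , p , _) one → p ; (_ , _ , p) both → p })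
       (λ ∀P → ∀P none , ∀P one , ∀P both)
       (P? none ×-dec P? one ×-dec P? both)

complement-balanced : ∀ x y → weight (complement x) + weight (complement y) ≡ 2 → weight x + weight y ≡ 2
complement-balanced none both _ = refl
complement-balanced one  one  _ = refl
complement-balanced both none _ = refl
complement-balanced none none ()
complement-balanced none one  ()
complement-balanced one  none ()
complement-balanced one  both ()
complement-balanced both one  ()
complement-balanced both both ()

loadOf : Bool → Bool → Load
loadOf false false = none
loadOf false true  = one
loadOf true  false = one
loadOf true  true  = both

loadOf-both : ∀ {x y} → loadOf x y ≡ both → x ≡ true × y ≡ true
loadOf-both {true}  {true}  _ = refl , refl
loadOf-both {false} {false} ()
loadOf-both {false} {true}  ()
loadOf-both {true}  {false} ()

loadOf-none : ∀ {x y} → loadOf x y ≡ none → x ≡ false × y ≡ false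
loadOf-none {false} {false} _ = refl , refl
loadOf-none {false} {true}  ()
loadOf-none {true}  {false} ()
loadOf-none {true}  {true}  ()

loadOf-one : ∀ {x y} → loadOf x y ≡ one → y ≡ true ⇔ x ≡ false
loadOf-one {false} {true}  _ = mk⇔ (λ _ → refl) (λ _ → refl)
loadOf-one {true}  {false} _ = mk⇔ (λ ()) (λ ())
loadOf-one {false} {false} ()
loadOf-one {true}  {true}  ()

load : (Pt → Bool) → Fin 6 → Load
load S j = loadOf (S (P j)) (S (Q j))

load-cong : ∀ {S T : Pt → Bool} → S ≗ T → load S ≗ load T
load-cong S≗T j = cong₂ loadOf (S≗T (P j)) (S≗T (Q j))

load-not : ∀ S → load (not ∘ S) ≗ complement ∘ load S
load-not S j with S (P j) | S (Q j)
... | false | false = refl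
... | false | true  = refl
... | true  | false = refl
... | true  | true  = refl

edgeWeight : (Fin 6 → Load) → Fin 6 → Fin 6 → ℕ
edgeWeight ℓ a b = weight (ℓ a) + weight (ℓ b)

edgeWeight-cong : ∀ {ℓ ℓ′} → ℓ ≗ ℓ′ → ∀ a b → edgeWeight ℓ a b ≡ edgeWeight ℓ′ a b
edgeWeight-cong ℓ≗ℓ′ a b = cong₂ _+_ (cong weight (ℓ≗ℓ′ a)) (cong weight (ℓ≗ℓ′ b))

countᵇ-map : ∀ {A : Set} (f : A → Bool) xs → countᵇ f xs ≡ countᵇ id (map f xs)
countᵇ-map f []       = refl
countᵇ-map f (x ∷ xs) with f x
... | true  = cong ℕ.suc (countᵇ-map f xs)
... | false = countᵇ-map f xs

countᵇ-pairs : ∀ x y z w → countᵇ id (x ∷ y ∷ z ∷ w ∷ []) ≡ weight (loadOf x z) + weight (loadOf y w)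
countᵇ-pairs false false false false = refl
countᵇ-pairs false false false true  = refl
countᵇ-pairs false false true  false = refl
countᵇ-pairs false false true  true  = refl
countᵇ-pairs false true  false false = refl
countᵇ-pairs false true  false true  = refl
countᵇ-pairs false true  true  false = refl
countᵇ-pairs false true  true  true  = refl
countᵇ-pairs true  false false false = refl
countᵇ-pairs true  false false true  = refl
countᵇ-pairs true  false true  false = refl
countᵇ-pairs true  false true  true  = refl
countᵇ-pairs true  true  false false = refl
countᵇ-pairs true  true  false true  = refl
countᵇ-pairs true  true  true  false = refl
countᵇ-pairs true  true  true  true  = refl

cnt4≡edgeWeight : ∀ S a b → cnt4 S a b ≡ edgeWeight (load S) a b
cnt4≡edgeWeight S a b =
  trans (countᵇ-map S (P a ∷ P b ∷ Q a ∷ Q b ∷ [])) (countᵇ-pairs (S (P a)) (S (P b)) (S (Q a)) (S (Q b)))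

NoBalancedEdge : (Fin 6 → Load) → Set
NoBalancedEdge ℓ = ∀ a b → K33Edge a b → edgeWeight ℓ a b ≢ 2

HasHeavyEdge : (Fin 6 → Load) → Set
HasHeavyEdge ℓ = ∃₂ λ a b → K33Edge a b × 3 ≤ edgeWeight ℓ a b

data Position (i j : Fin 6) : Set where
  centre   : j ≡ i → Position i j
  aligned  : j ≢ i → parity j ≡ parity i → Position i j
  opposite : parity j ≢ parity i → Position i j

position : ∀ i j → Position i j
position i j with j ≟ i | parity j ℕ.≟ parity i
... | yes j≡i | _        = centre j≡i
... | no j≢i  | yes same = aligned j≢i same
... | no _    | no diff  = opposite diff

positionLoad : ∀ {i j} → Position i j → Load
positionLoad (centre _)    = both
positionLoad (aligned _ _) = none
positionLoad (opposite _)  = one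

star : Fin 6 → Fin 6 → Load
star i j = positionLoad (position i j)

IsStar : (Fin 6 → Load) → Fin 6 → Set
IsStar ℓ i = ∀ j → ℓ j ≡ star i j

k33Edge? : ∀ a b → Dec (K33Edge a b)
k33Edge? a b = (_ ℕ.≟ 1) ×-dec (_ ℕ.≟ 0)

noBalancedEdge? : ∀ ℓ → Dec (NoBalancedEdge ℓ)
noBalancedEdge? ℓ = all? λ a → all? λ b → k33Edge? a b →-dec ¬? (edgeWeight ℓ a b ℕ.≟ 2)

hasHeavyEdge? : ∀ ℓ → Dec (HasHeavyEdge ℓ)
hasHeavyEdge? ℓ = any? λ a → any? λ b → k33Edge? a b ×-dec 3 ≤? edgeWeight ℓ a b

isStar? : ∀ ℓ i → Dec (IsStar ℓ i)
isStar? ℓ i = all? λ j → ℓ j ≟ᴸ star i j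

star-or-costar-table : ∀ (v : Vec Load 6) →
  NoBalancedEdge (lookup v) → HasHeavyEdge (lookup v) → HasHeavyEdge (complement ∘ lookup v) →
  ∃ λ i → IsStar (lookup v) i ⊎ IsStar (complement ∘ lookup v) i
star-or-costar-table = from-yes (searchable-Vec searchable-Load 6 λ v →
  noBalancedEdge? (lookup v) →-dec hasHeavyEdge? (lookup v) →-dec hasHeavyEdge? (complement ∘ lookup v) →-dec
  any? λ i → isStar? (lookup v) i ⊎-dec isStar? (complement ∘ lookup v) i)

noBalancedEdge-cong : ∀ {ℓ ℓ′} → ℓ ≗ ℓ′ → NoBalancedEdge ℓ → NoBalancedEdge ℓ′
noBalancedEdge-cong ℓ≗ℓ′ noBalanced a b e balanced = noBalanced a b e (trans (edgeWeight-cong ℓ≗ℓ′ a b) balanced)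

hasHeavyEdge-cong : ∀ {ℓ ℓ′} → ℓ ≗ ℓ′ → HasHeavyEdge ℓ → HasHeavyEdge ℓ′
hasHeavyEdge-cong ℓ≗ℓ′ (a , b , e , heavy) = a , b , e , subst (3 ≤_) (edgeWeight-cong ℓ≗ℓ′ a b) heavy

isStar-cong : ∀ {ℓ ℓ′ i} → ℓ ≗ ℓ′ → IsStar ℓ i → IsStar ℓ′ i
isStar-cong ℓ≗ℓ′ isStar j = trans (sym (ℓ≗ℓ′ j)) (isStar j)

star-or-costar : ∀ ℓ → NoBalancedEdge ℓ → HasHeavyEdge ℓ → HasHeavyEdge (complement ∘ ℓ) →
  ∃ λ i → IsStar ℓ i ⊎ IsStar (complement ∘ ℓ) i
star-or-costar ℓ noBalanced heavy light =
  map₂ (Sum.map (isStar-cong (lookup∘tabulate ℓ)) (isStar-cong (cong complement ∘ lookup∘tabulate ℓ)))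
    (star-or-costar-table (tabulate ℓ) (noBalancedEdge-cong ℓ≗v noBalanced)
      (hasHeavyEdge-cong ℓ≗v heavy) (hasHeavyEdge-cong (cong complement ∘ ℓ≗v) light))
  where
  ℓ≗v : ℓ ≗ lookup (tabulate ℓ)
  ℓ≗v j = sym (lookup∘tabulate ℓ j)

noBalancedEdge-complement : ∀ {ℓ} → NoBalancedEdge ℓ → NoBalancedEdge (complement ∘ ℓ)
noBalancedEdge-complement {ℓ} noBalanced a b e balanced = noBalanced a b e (complement-balanced (ℓ a) (ℓ b) balanced)

side-noBalancedEdge : ∀ X → IsBond X → ∀ k → NoBalancedEdge (load (side X k))
side-noBalancedEdge X (_ , irreducible) k a b e balanced =
  irreducible a b e k (trans (cnt4≡edgeWeight (side X k) a b) balanced)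

cut-noBalancedEdge : ∀ X I → IsBond X → IsInducedCut X I → NoBalancedEdge (load I)
cut-noBalancedEdge X I bond (k , inj₁ I≗S) =
  noBalancedEdge-cong (load-cong (sym ∘ I≗S)) (side-noBalancedEdge X bond k)
cut-noBalancedEdge X I bond (k , inj₂ I≗∁S) =
  noBalancedEdge-cong (λ j → sym (trans (load-cong I≗∁S j) (load-not (side X k) j)))
    (noBalancedEdge-complement {load (side X k)} (side-noBalancedEdge X bond k))

coloring-heavyEdges : ∀ I → ColoringSurjective I → HasHeavyEdge (load I) × HasHeavyEdge (complement ∘ load I)
coloring-heavyEdges I ((a , b , e , red) , (a′ , b′ , e′ , blue)) =
  (a , b , e , subst (3 ≤_) (cnt4≡edgeWeight I a b) red) ,
  (a′ , b′ , e′ , subst (3 ≤_) (trans (cnt4≡edgeWeight (not ∘ I) a′ b′) (edgeWeight-cong (load-not I) a′ b′)) blue)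

InForm : Fin 6 → (Fin 6 → Bool) → Pt → Set
InForm i c p = p ≡ P i ⊎ p ≡ Q i ⊎ ∃ λ j → parity j ≢ parity i × p ≡ pick (c j) j

P≡pick : ∀ {j k b} → P j ≡ pick b k → j ≡ k × b ≡ true
P≡pick {b = true} refl = refl , refl

Q≡pick : ∀ {j k b} → Q j ≡ pick b k → j ≡ k × b ≡ false
Q≡pick {b = false} refl = refl , refl

inForm-P : ∀ {i c j} → InForm i c (P j) ⇔ (j ≡ i ⊎ parity j ≢ parity i × c j ≡ true)
inForm-P {i} {c} {j} = mk⇔ to from
  where
  to : InForm i c (P j) → j ≡ i ⊎ parity j ≢ parity i × c j ≡ true
  to (inj₁ refl) = inj₁ refl
  to (inj₂ (inj₂ (k , diff , P≡))) with P≡pick P≡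
  ... | refl , ck = inj₂ (diff , ck)
  from : j ≡ i ⊎ parity j ≢ parity i × c j ≡ true → InForm i c (P j)
  from (inj₁ refl) = inj₁ refl
  from (inj₂ (diff , cj)) = inj₂ (inj₂ (j , diff , cong (λ b → pick b j) (sym cj)))

inForm-Q : ∀ {i c j} → InForm i c (Q j) ⇔ (j ≡ i ⊎ parity j ≢ parity i × c j ≡ false)
inForm-Q {i} {c} {j} = mk⇔ to from
  where
  to : InForm i c (Q j) → j ≡ i ⊎ parity j ≢ parity i × c j ≡ false
  to (inj₂ (inj₁ refl)) = inj₁ refl
  to (inj₂ (inj₂ (k , diff , Q≡))) with Q≡pick Q≡
  ... | refl , ck = inj₂ (diff , ck)
  from : j ≡ i ⊎ parity j ≢ parity i × c j ≡ false → InForm i c (Q j)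
  from (inj₁ refl) = inj₂ (inj₁ refl)
  from (inj₂ (diff , cj)) = inj₂ (inj₂ (j , diff , cong (λ b → pick b j) (sym cj)))

∉-aligned : ∀ {i j : Fin 6} {B : Set} → j ≢ i → parity j ≡ parity i → ¬ (j ≡ i ⊎ parity j ≢ parity i × B)
∉-aligned j≢i same (inj₁ j≡i)        = j≢i j≡i
∉-aligned j≢i same (inj₂ (diff , _)) = diff same

module _ (S : Pt → Bool) {i j : Fin 6} where

  member-P : (pos : Position i j) → load S j ≡ positionLoad pos →
    S (P j) ≡ true ⇔ (j ≡ i ⊎ parity j ≢ parity i × S (P j) ≡ true)
  member-P (centre refl) full = mk⇔ (λ _ → inj₁ refl) (λ _ → proj₁ (loadOf-both full))
  member-P (aligned j≢i same) empty = mk⇔ (λ s → contradiction (trans (sym s) (proj₁ (loadOf-none empty))) λ ())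
    (λ m → contradiction m (∉-aligned j≢i same))
  member-P (opposite diff) _ = mk⇔ (λ s → inj₂ (diff , s)) λ
    { (inj₁ refl) → contradiction refl diff ; (inj₂ (_ , s)) → s }

  member-Q : (pos : Position i j) → load S j ≡ positionLoad pos →
    S (Q j) ≡ true ⇔ (j ≡ i ⊎ parity j ≢ parity i × S (P j) ≡ false)
  member-Q (centre refl) full = mk⇔ (λ _ → inj₁ refl) (λ _ → proj₂ (loadOf-both full))
  member-Q (aligned j≢i same) empty = mk⇔ (λ s → contradiction (trans (sym s) (proj₂ (loadOf-none empty))) λ ())
    (λ m → contradiction m (∉-aligned j≢i same))
  member-Q (opposite diff) half = mk⇔ (λ s → inj₂ (diff , Equivalence.to (loadOf-one half) s)) λ
    { (inj₁ refl) → contradiction refl diff ; (inj₂ (_ , s)) → Equivalence.from (loadOf-one half) s }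

star⇒HasForm : ∀ S i → IsStar (load S) i → HasForm S
star⇒HasForm S i isStar = i , S ∘ P , λ p → Equivalence.to (membership p) , Equivalence.from (membership p)
  where
  membership : ∀ p → S p ≡ true ⇔ InForm i (S ∘ P) p
  membership (P j) = ⇔.trans (member-P S (position i j) (isStar j)) (⇔.sym inForm-P)
  membership (Q j) = ⇔.trans (member-Q S (position i j) (isStar j)) (⇔.sym inForm-Q)

-- The form is closed under exchanging the P's and the Q's (flip every choice),
-- so sPQ = false always suffices.
star-or-costar⇒HasForm : ∀ I → (∃ λ i → IsStar (load I) i ⊎ IsStar (complement ∘ load I) i) →
  ∃₂ λ (sIJ sPQ : Bool) → HasForm (swapped sIJ sPQ I)
star-or-costar⇒HasForm I (i , inj₁ isStar) = false , false , star⇒HasForm I i isStar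
star-or-costar⇒HasForm I (i , inj₂ isStar) =
  true , false , star⇒HasForm (not ∘ I) i (λ j → trans (load-not I j) (isStar j))

lemma4p22 : (X : StableCurve) (I : Pt → Bool) → IsBond X → IsInducedCut X I →
    ColoringSurjective I → ∃₂ λ (sIJ sPQ : Bool) → HasForm (swapped sIJ sPQ I)
lemma4p22 X I bond cut surjective =
  star-or-costar⇒HasForm I
    (uncurry (star-or-costar (load I) (cut-noBalancedEdge X I bond cut)) (coloring-heavyEdges I surjective))
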